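{- For every integer $n \geq 3$, the $3$-token graph $\Gamma_3(P_n)$ of the path $P_n$ satisfies: (1) $\chi(\Gamma_3(P_n)) = \omega(\Gamma_3(P_n)) = 1$ if $n=3$ and $=2$ if $n>3$; (2) $\alpha(\Gamma_3(P_n)) = \dfrac{n^3-3n^2+2n}{12}$ if $n$ is even and $\alpha(\Gamma_3(P_n)) = \dfrac{n^3-3n^2+5n-3}{12}$ if $n$ is odd; (3) $\operatorname{diam}(\Gamma_3(P_n)) = 3(n-3)$.
   Context: All graphs are finite, simple and undirected. $P_n$ is the path with vertices $x_1,\dots,x_n$ and edges $x_ix_{i+1}$. The $3$-token graph $\Gamma_3(G)$ has as vertices the $3$-element subsets of $V(G)$, two distinct subsets $A,B$ being adjacent iff $A\triangle B=\{x,y\}$ with $xy\in E(G)$. $\chi$, $\omega$, $\alpha$ and $\operatorname{diam}$ denote chromatic number, clique number, independence number and diameter (maximum shortest-path distance). -}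

module Defs where

open import Level using (0ℓ)
open import Data.Nat using (ℕ; zero; suc; _≤_)
open import Data.Fin using (Fin; toℕ)
open import Data.Fin.Subset using (Subset; _─_; _∪_; ⁅_⁆; ∣_∣)
open import Data.Product using (Σ; ∃; ∃-syntax; _×_; _,_)
open import Data.Sum using (_⊎_)
open import Data.List using (List; length)
open import Data.List.Membership.Propositional using (_∈_)
open import Data.List.Relation.Unary.Unique.Propositional using (Unique)
open import Relation.Nullary using (¬_)
open import Relation.Binary.PropositionalEquality using (_≡_; _≢_)

record Graph : Set₁ where
  field
    V   : Set
    Adj : V → V → Set
open Graph public

-- The path P_n on vertices Fin n (x_{i+1} ↔ index i); edges x_i x_{i+1}.
PathAdj : (n : ℕ) → Fin n → Fin n → Set
PathAdj n x y = (toℕ y ≡ suc (toℕ x)) ⊎ (toℕ x ≡ suc (toℕ y))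

_△_ : {n : ℕ} → Subset n → Subset n → Subset n
A △ B = (A ─ B) ∪ (B ─ A)

TokenGraph3 : (n : ℕ) → (Fin n → Fin n → Set) → Graph
TokenGraph3 n E = record
  { V   = Σ (Subset n) (λ A → ∣ A ∣ ≡ 3)
  ; Adj = λ { (A , _) (B , _) → ∃[ x ] ∃[ y ] (E x y × (A △ B ≡ ⁅ x ⁆ ∪ ⁅ y ⁆)) }
  }

Γ₃P : ℕ → Graph
Γ₃P n = TokenGraph3 n (PathAdj n)

module _ (G : Graph) where

  -- finite vertex sets as duplicate-free lists
  IsClique : List (V G) → Set
  IsClique S = Unique S × (∀ {u v} → u ∈ S → v ∈ S → u ≢ v → Adj G u v)

  IsIndependent : List (V G) → Set
  IsIndependent S = Unique S × (∀ {u v} → u ∈ S → v ∈ S → ¬ Adj G u v)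

  CliqueNumber : ℕ → Set
  CliqueNumber k = (∃[ S ] (IsClique S × length S ≡ k))
                 × (∀ S → IsClique S → length S ≤ k)

  IndependenceNumber : ℕ → Set
  IndependenceNumber k = (∃[ S ] (IsIndependent S × length S ≡ k))
                       × (∀ S → IsIndependent S → length S ≤ k)

  ProperColouring : (k : ℕ) → (V G → Fin k) → Set
  ProperColouring k c = ∀ {u v} → Adj G u v → c u ≢ c v

  ChromaticNumber : ℕ → Set
  ChromaticNumber k = (∃[ c ] ProperColouring k c)
                    × (∀ m (c : V G → Fin m) → ProperColouring m c → k ≤ m)

  data Walk : V G → V G → ℕ → Set where
    [] : ∀ {u} → Walk u u 0
    _∷_ : ∀ {u v w l} → Adj G u v → Walk v w l → Walk u w (suc l)

  DistLe : V G → V G → ℕ → Set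
  DistLe u v d = ∃[ l ] (l ≤ d × Walk u v l)

  Diameter : ℕ → Set
  Diameter D = (∀ u v → DistLe u v D)
             × (∃[ u ] ∃[ v ] (∀ l → Walk u v l → D ≤ l))

{-# OPTIONS --safe #-}
-- A 3-set is a bit vector, and two 3-sets are adjacent in Γ₃(Pₙ) exactly when one is
-- obtained from the other by sliding a token to a free neighbouring vertex.  A slide
-- changes the weight (the sum of the distances of the tokens to the last vertex) by
-- exactly one, so the parity of the weight is a proper 2-colouring: there are no
-- triangles, and χ = ω = 2 as soon as there is an edge (n ≥ 4), while Γ₃(P₃) is a single
-- vertex.  The weight ranges over an interval of length 3(n − 3), which bounds the
-- diameter from below, and any two k-sets are joined by at most k(n − k) slides.  The
-- odd-weight triples form an independent set.  Pairing the vertices 2i, 2i + 1 and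
-- sliding inside the first half-filled pair sends every even-weight triple to an adjacent
-- odd one, injectively; so an independent set injects into the odd class, whose size is
-- found by recursion on n.
module Submission where

open import Defs
open import Data.Fin.Base using (Fin; zero; suc; toℕ)
open import Data.Fin.Subset using (Subset; inside; outside; ⊥; ⊤; ⁅_⁆; _∪_; ∣_∣)
open import Data.Fin.Subset.Properties using (∪-idem; ∪-comm; ∣p∣≤n; ∣⊥∣≡0; ∣p∣≡n⇒p≡⊤)
open import Data.List.Base using (List; []; _∷_; [_]; length; map; _++_)
open import Data.List.Membership.Propositional using (_∈_; _─_)
open import Data.List.Membership.Propositional.Properties
  using (∈-allFin; ∈-map⁺; ∈-map⁻; ∈-++⁺ˡ; ∈-++⁺ʳ; ∈-++⁻)
open import Data.List.Properties using (length-map; length-++; length-tabulate; length-removeAt′)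
open import Data.List.Relation.Unary.All as All using ([]; _∷_)
open import Data.List.Relation.Unary.AllPairs using ([]; _∷_)
open import Data.List.Relation.Unary.Any using (here; there; index)
open import Data.List.Relation.Unary.Unique.Propositional using (Unique)
import Data.List.Relation.Unary.Unique.Propositional.Properties as Unique
open import Data.Nat.Base
  using (ℕ; zero; suc; _≤_; _<_; _+_; _*_; _∸_; _^_; _/_; z≤n; s≤s; ⌊_/2⌋; parity; NonZero)
open import Data.Nat.Properties
  using ( module ≤-Reasoning; ≡-irrelevant; suc-injective; m≢1+n+m
        ; ≤-refl; ≤-reflexive; ≤-trans; ≤-pred; n≤1+n; m≤n+m
        ; +-suc; +-comm; +-identityʳ; +-mono-≤; +-cancelˡ-≤; *-comm; *-assoc; *-distribˡ-+
        ; *-monoˡ-≤; *-monoʳ-≤; ∸-monoˡ-≤; +-∸-assoc; +-∸-comm; ∸-+-assoc; m+n∸n≡m)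
open import Data.Nat.Divisibility using (_∣_; divides; m%n≡0⇒n∣m)
open import Data.Nat.DivMod using (_%_; m*n/n≡m; m≡m%n+[m/n]*n; m%n<n)
open import Data.Nat.Solver using (module +-*-Solver)
open import Data.Nat.Tactic.RingSolver using (solve)
open import Data.Parity.Base as ℙ using (Parity; 0ℙ; 1ℙ; _⁻¹)
import Data.Parity.Properties as ℙₚ
open import Data.Product.Base using (Σ; ∃₂; ∃-syntax; _×_; _,_; proj₁; proj₂)
open import Data.Sum.Base using (_⊎_; inj₁; inj₂)
open import Data.Vec.Base using ([]; _∷_)
open import Data.Vec.Properties using (∷-injectiveʳ)
open import Function.Base using (_∘_)
open import Relation.Nullary using (¬_; contradiction)
open import Relation.Binary.PropositionalEquality
  using (_≡_; _≢_; refl; sym; trans; cong; cong₂; subst; subst₂; ≢-sym; module ≡-Reasoning)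

private variable
  n k : ℕ

∈-─ : {X : Set} {x z : X} {ys : List X} (x∈ys : x ∈ ys) → z ∈ ys → z ≢ x → z ∈ ys ─ x∈ys
∈-─ (here refl)  (here refl)  z≢x = contradiction refl z≢x
∈-─ (here refl)  (there z∈ys) _   = z∈ys
∈-─ (there _)    (here refl)  _   = here refl
∈-─ (there x∈ys) (there z∈ys) z≢x = there (∈-─ x∈ys z∈ys z≢x)

injectiveOn⇒length≤ : {X Y : Set} (f : X → Y) {xs : List X} {ys : List Y} → Unique xs →
                      (∀ {x y} → x ∈ xs → y ∈ xs → x ≢ y → f x ≢ f y) →
                      (∀ {x} → x ∈ xs → f x ∈ ys) → length xs ≤ length ys
injectiveOn⇒length≤ f {[]}     _            _   _    = z≤n
injectiveOn⇒length≤ f {x ∷ xs} {ys} (x∉xs ∷ xs!) inj into = begin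
  suc (length xs)           ≤⟨ s≤s (injectiveOn⇒length≤ f xs! (λ p q → inj (there p) (there q)) into′) ⟩
  suc (length (ys ─ fx∈ys)) ≡⟨ length-removeAt′ ys (index fx∈ys) ⟨
  length ys                 ∎
  where
  open ≤-Reasoning
  fx∈ys = into (here refl)
  into′ : ∀ {y} → y ∈ xs → f y ∈ ys ─ fx∈ys
  into′ y∈xs = ∈-─ fx∈ys (into (there y∈xs))
                   (inj (there y∈xs) (here refl) (≢-sym (All.lookup x∉xs y∈xs)))

module _ (G : Graph) where

  singleton-clique : ∀ {u} → IsClique G [ u ]
  singleton-clique = [] ∷ [] , λ where (here refl) (here refl) u≢u → contradiction refl u≢u

  edge-clique : ∀ {u v} → (∀ {x y} → Adj G x y → Adj G y x) → Adj G u v → u ≢ v →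
                IsClique G (u ∷ v ∷ [])
  edge-clique symmetric uv u≢v = ((u≢v ∷ []) ∷ [] ∷ []) , λ where
    (here refl)         (here refl)         u≢u → contradiction refl u≢u
    (here refl)         (there (here refl)) _   → uv
    (there (here refl)) (here refl)         _   → symmetric uv
    (there (here refl)) (there (here refl)) v≢v → contradiction refl v≢v

  clique-length≤colours : ∀ {k c S} → ProperColouring G k c → IsClique G S → length S ≤ k
  clique-length≤colours {k} {c} proper (S! , clique) =
    subst (_ ≤_) (length-tabulate {n = k} (λ i → i))
      (injectiveOn⇒length≤ c S! (λ u∈S v∈S u≢v → proper (clique u∈S v∈S u≢v)) (λ _ → ∈-allFin _))

  clique∧colouring⇒χ≡ω : ∀ {S c} → IsClique G S → ProperColouring G (length S) c →
                         ChromaticNumber G (length S) × CliqueNumber G (length S)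
  clique∧colouring⇒χ≡ω {S} {c} clique proper =
      ((c , proper) , λ _ _ proper′ → clique-length≤colours proper′ clique)
    , ((S , clique , refl) , λ _ clique′ → clique-length≤colours proper clique′)

  independenceNumber-via-collapse :
    ∀ {L} → IsIndependent G L → (g : V G → V G) →
    (∀ {u v} → u ≢ v → g u ≡ g v → Adj G u v) → (∀ u → g u ∈ L) →
    IndependenceNumber G (length L)
  independenceNumber-via-collapse {L} independent g collapse into =
    (L , independent , refl) , λ S (S! , S-independent) →
      injectiveOn⇒length≤ g S! (λ u∈S v∈S u≢v e → S-independent u∈S v∈S (collapse u≢v e))
                                (λ _ → into _)

module _ {G : Graph} where

  private variable
    x y z : V G
    l m d e : ℕ

  _++ʷ_ : Walk G x y l → Walk G y z m → Walk G x z (l + m)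
  []      ++ʷ q = q
  (a ∷ p) ++ʷ q = a ∷ (p ++ʷ q)

  reverseʷ : (∀ {x y} → Adj G x y → Adj G y x) → Walk G x y l → Walk G y x l
  reverseʷ symmetric []      = []
  reverseʷ symmetric (a ∷ p) =
    subst (Walk G _ _) (+-comm _ 1) (reverseʷ symmetric p ++ʷ (symmetric a ∷ []))

  mapʷ : {H : Graph} (f : V G → V H) → (∀ {x y} → Adj G x y → Adj H (f x) (f y)) →
         Walk G x y l → Walk H (f x) (f y) l
  mapʷ f f-adj []      = []
  mapʷ f f-adj (a ∷ p) = f-adj a ∷ mapʷ f f-adj p

  walk-lipschitz : (f : V G → ℕ) → (∀ {x y} → Adj G x y → f y ≤ suc (f x)) →
                   Walk G x y l → f y ≤ f x + l
  walk-lipschitz f step [] = ≤-reflexive (sym (+-identityʳ _))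
  walk-lipschitz {x = x} {y = y} f step (_∷_ {v = w} {l = l} a p) = begin
    f y           ≤⟨ walk-lipschitz f step p ⟩
    f w + l       ≤⟨ +-mono-≤ (step a) ≤-refl ⟩
    suc (f x) + l ≡⟨ +-suc (f x) l ⟨
    f x + suc l   ∎
    where open ≤-Reasoning

  DistLe-mono : d ≤ e → DistLe G x y d → DistLe G x y e
  DistLe-mono d≤e (l , l≤d , p) = l , ≤-trans l≤d d≤e , p

  DistLe-trans : DistLe G x y d → DistLe G y z e → DistLe G x z (d + e)
  DistLe-trans (l , l≤d , p) (m , m≤e , q) = l + m , +-mono-≤ l≤d m≤e , p ++ʷ q

  DistLe-sym : (∀ {x y} → Adj G x y → Adj G y x) → DistLe G x y d → DistLe G y x d
  DistLe-sym symmetric (l , l≤d , p) = l , l≤d , reverseʷ symmetric p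

  DistLe-map : {H : Graph} (f : V G → V H) → (∀ {x y} → Adj G x y → Adj H (f x) (f y)) →
               DistLe G x y d → DistLe H (f x) (f y) d
  DistLe-map f f-adj (l , l≤d , p) = l , l≤d , mapʷ f f-adj p

-- Sliding tokens along a path

private variable
  A B : Subset n

data Slide : Subset n → Subset n → Set where
  right : Slide (inside ∷ outside ∷ A) (outside ∷ inside ∷ A)
  left  : Slide (outside ∷ inside ∷ A) (inside ∷ outside ∷ A)
  there : ∀ x → Slide A B → Slide (x ∷ A) (x ∷ B)

SlideGraph : ℕ → Graph
SlideGraph n = record { V = Subset n ; Adj = Slide }

slide-sym : Slide A B → Slide B A
slide-sym right       = left
slide-sym left        = right
slide-sym (there x s) = there x (slide-sym s)

slide-size : Slide A B → ∣ A ∣ ≡ ∣ B ∣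
slide-size right             = refl
slide-size left              = refl
slide-size (there inside s)  = cong suc (slide-size s)
slide-size (there outside s) = slide-size s

weight : Subset n → ℕ
weight []                   = 0
weight {suc n} (inside ∷ A) = n + weight A
weight (outside ∷ A)        = weight A

slide-weight : Slide A B → weight A ≡ suc (weight B) ⊎ weight B ≡ suc (weight A)
slide-weight right = inj₁ refl
slide-weight left  = inj₂ refl
slide-weight {suc n} (there inside s) with slide-weight s
... | inj₁ e = inj₁ (trans (cong (n +_) e) (+-suc n _))
... | inj₂ e = inj₂ (trans (cong (n +_) e) (+-suc n _))
slide-weight (there outside s) = slide-weight s

slide-weight≤ : Slide A B → weight B ≤ suc (weight A)
slide-weight≤ s with slide-weight s
... | inj₁ e = ≤-trans (n≤1+n _) (≤-trans (≤-reflexive (sym e)) (n≤1+n _))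
... | inj₂ e = ≤-reflexive e

parity-suc : ∀ m → parity (suc m) ≡ parity m ⁻¹
parity-suc m = sym (ℙₚ.⁻¹-selfInverse (ℙₚ.suc-homo-⁻¹ m))

slide-parity : Slide A B → parity (weight B) ≡ parity (weight A) ⁻¹
slide-parity {A = A} {B = B} s with slide-weight s
... | inj₁ e = sym (ℙₚ.⁻¹-selfInverse (sym (trans (cong parity e) (parity-suc (weight B)))))
... | inj₂ e = trans (cong parity e) (parity-suc (weight A))

△-self : (A : Subset n) → A △ A ≡ ⊥
△-self []            = refl
△-self (inside ∷ A)  = cong (outside ∷_) (△-self A)
△-self (outside ∷ A) = cong (outside ∷_) (△-self A)

△≡⊥⇒≡ : A △ B ≡ ⊥ → A ≡ B
△≡⊥⇒≡ {A = []}          {[]}          _ = refl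
△≡⊥⇒≡ {A = inside ∷ A}  {inside ∷ B}  e = cong (inside ∷_) (△≡⊥⇒≡ (∷-injectiveʳ e))
△≡⊥⇒≡ {A = outside ∷ A} {outside ∷ B} e = cong (outside ∷_) (△≡⊥⇒≡ (∷-injectiveʳ e))

△-there : ∀ x → (x ∷ A) △ (x ∷ B) ≡ outside ∷ (A △ B)
△-there inside  = refl
△-there outside = refl

first-pair-△ : (A : Subset n) → inside ∷ inside ∷ (A △ A) ≡ ⁅ zero ⁆ ∪ ⁅ suc zero ⁆
first-pair-△ A = cong (λ C → inside ∷ inside ∷ C) (trans (△-self A) (sym (∪-idem ⊥)))

slide⇒△ : Slide A B → ∃₂ λ x y → toℕ y ≡ suc (toℕ x) × A △ B ≡ ⁅ x ⁆ ∪ ⁅ y ⁆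
slide⇒△ {A = _ ∷ _ ∷ A} right = zero , suc zero , refl , first-pair-△ A
slide⇒△ {A = _ ∷ _ ∷ A} left  = zero , suc zero , refl , first-pair-△ A
slide⇒△ (there x s) with i , j , ij , e ← slide⇒△ s =
  suc i , suc j , cong suc ij , trans (△-there x) (cong (outside ∷_) e)

first-pair-slide : ∀ {C : Subset n} a a′ b b′ → (a ∷ a′ ∷ A) △ (b ∷ b′ ∷ A) ≡ inside ∷ inside ∷ C →
                   ∣ a ∷ a′ ∷ A ∣ ≡ ∣ b ∷ b′ ∷ A ∣ → Slide (a ∷ a′ ∷ A) (b ∷ b′ ∷ A)
first-pair-slide inside  outside outside inside  _  _ = right
first-pair-slide outside inside  inside  outside _  _ = left
first-pair-slide inside  inside  outside outside _  s = contradiction (sym s) (m≢1+n+m _)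
first-pair-slide outside outside inside  inside  _  s = contradiction s (m≢1+n+m _)
first-pair-slide inside  _       inside  _       () _
first-pair-slide outside _       outside _       () _
first-pair-slide inside  inside  outside inside  () _
first-pair-slide inside  outside outside outside () _
first-pair-slide outside inside  inside  inside  () _
first-pair-slide outside outside inside  outside () _

△⇒slide : {x y : Fin n} → toℕ y ≡ suc (toℕ x) → A △ B ≡ ⁅ x ⁆ ∪ ⁅ y ⁆ → ∣ A ∣ ≡ ∣ B ∣ → Slide A B
△⇒slide {A = a ∷ a′ ∷ A} {b ∷ b′ ∷ B} {zero} {suc zero} refl e s
  with refl ← △≡⊥⇒≡ {A = A} {B} (trans (∷-injectiveʳ (∷-injectiveʳ e)) (∪-idem ⊥))
  = first-pair-slide a a′ b b′ e s
△⇒slide {A = inside ∷ A}  {inside ∷ B}  {suc x} {suc y} xy e s =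
  there inside (△⇒slide (suc-injective xy) (∷-injectiveʳ e) (suc-injective s))
△⇒slide {A = outside ∷ A} {outside ∷ B} {suc x} {suc y} xy e s =
  there outside (△⇒slide (suc-injective xy) (∷-injectiveʳ e) s)
△⇒slide {A = inside ∷ A}  {outside ∷ B} {suc x} {suc y} _ () _
△⇒slide {A = outside ∷ A} {inside ∷ B}  {suc x} {suc y} _ () _
△⇒slide {x = zero} {suc (suc y)} ()
△⇒slide {y = zero} ()

SizedSubset : ℕ → ℕ → Set
SizedSubset n k = Σ (Subset n) (λ A → ∣ A ∣ ≡ k)

sized-≡ : {u v : SizedSubset n k} → proj₁ u ≡ proj₁ v → u ≡ v
sized-≡ {u = A , p} {.A , q} refl = cong (A ,_) (≡-irrelevant p q)

private variable
  u v : V (Γ₃P n)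

slide⇒adj : Slide (proj₁ u) (proj₁ v) → Adj (Γ₃P n) u v
slide⇒adj s with x , y , xy , e ← slide⇒△ s = x , y , inj₁ xy , e

adj⇒slide : Adj (Γ₃P n) u v → Slide (proj₁ u) (proj₁ v)
adj⇒slide {u = _ , p} {v = _ , q} (x , y , inj₁ xy , e) = △⇒slide xy e (trans p (sym q))
adj⇒slide {u = _ , p} {v = _ , q} (x , y , inj₂ yx , e) =
  △⇒slide yx (trans e (∪-comm ⁅ x ⁆ ⁅ y ⁆)) (trans p (sym q))

adj-sym : Adj (Γ₃P n) u v → Adj (Γ₃P n) v u
adj-sym {u = u} {v} a = slide⇒adj {u = v} {u} (slide-sym (adj⇒slide {u = u} {v} a))

adj-parity : Adj (Γ₃P n) u v → parity (weight (proj₁ v)) ≡ parity (weight (proj₁ u)) ⁻¹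
adj-parity {u = u} {v} a = slide-parity (adj⇒slide {u = u} {v} a)

adj⇒≢ : Adj (Γ₃P n) u v → u ≢ v
adj⇒≢ {u = u} a refl = ℙₚ.p≢p⁻¹ _ (adj-parity {u = u} {u} a)

-- Chromatic and clique numbers

parityColour : Parity → Fin 2
parityColour 0ℙ = zero
parityColour 1ℙ = suc zero

parityColour-⁻¹ : ∀ p → parityColour p ≢ parityColour (p ⁻¹)
parityColour-⁻¹ 0ℙ ()
parityColour-⁻¹ 1ℙ ()

weightParityColouring : ProperColouring (Γ₃P n) 2 (λ u → parityColour (parity (weight (proj₁ u))))
weightParityColouring {u = u} {v} a e =
  parityColour-⁻¹ _ (trans e (cong parityColour (adj-parity {u = u} {v} a)))

Γ₃P₃-vertex : (u : V (Γ₃P 3)) → u ≡ (⊤ , refl)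
Γ₃P₃-vertex (A , p) = sized-≡ (∣p∣≡n⇒p≡⊤ p)

Γ₃P-χ≡ω≡1 : n ≡ 3 → ChromaticNumber (Γ₃P n) 1 × CliqueNumber (Γ₃P n) 1
Γ₃P-χ≡ω≡1 refl =
  clique∧colouring⇒χ≡ω (Γ₃P 3) (singleton-clique (Γ₃P 3) {⊤ , refl}) (λ {u} {v} → no-edges {u} {v})
  where
  no-edges : ProperColouring (Γ₃P 3) 1 (λ _ → zero)
  no-edges {u} {v} a _ = adj⇒≢ {u = u} {v} a (trans (Γ₃P₃-vertex u) (sym (Γ₃P₃-vertex v)))

Γ₃P-χ≡ω≡2 : 3 < n → ChromaticNumber (Γ₃P n) 2 × CliqueNumber (Γ₃P n) 2
Γ₃P-χ≡ω≡2 {n = suc (suc (suc (suc i)))} (s≤s (s≤s (s≤s (s≤s z≤n)))) =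
  clique∧colouring⇒χ≡ω (Γ₃P (4 + i))
    (edge-clique (Γ₃P (4 + i)) (λ {x} {y} → adj-sym {u = x} {y}) u₀v₀ (adj⇒≢ {u = u₀} {v₀} u₀v₀))
    (λ {u} {v} → weightParityColouring {u = u} {v})
  where
  u₀ v₀ : V (Γ₃P (4 + i))
  u₀ = inside ∷ inside ∷ inside ∷ outside ∷ ⊥ , cong (3 +_) (∣⊥∣≡0 i)
  v₀ = inside ∷ inside ∷ outside ∷ inside ∷ ⊥ , cong (3 +_) (∣⊥∣≡0 i)
  u₀v₀ : Adj (Γ₃P (4 + i)) u₀ v₀
  u₀v₀ = slide⇒adj {u = u₀} {v₀} (there inside (there inside right))

-- Diameter

slide-to-front : (A : Subset (suc n)) → ∣ A ∣ ≡ suc k →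
                 ∃[ B ] ∣ B ∣ ≡ k × DistLe (SlideGraph (suc n)) A (inside ∷ B) (n ∸ k)
slide-to-front (inside ∷ A) e = A , suc-injective e , 0 , z≤n , []
slide-to-front {n = zero} (outside ∷ []) ()
slide-to-front {n = suc n} {k} (outside ∷ A) e with B , ∣B∣≡k , A⇝B ← slide-to-front A e =
  outside ∷ B , ∣B∣≡k ,
  subst (DistLe _ _ _) (sym (trans (+-∸-assoc 1 k≤n) (+-comm 1 (n ∸ k))))
    (DistLe-trans (DistLe-map (outside ∷_) (there outside) A⇝B) (1 , ≤-refl , left ∷ []))
  where
  k≤n : k ≤ n
  k≤n = ≤-pred (subst (_≤ suc n) e (∣p∣≤n A))

slide-distance : (A B : Subset n) → ∣ A ∣ ≡ k → ∣ B ∣ ≡ k →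
                 DistLe (SlideGraph n) A B (k * (n ∸ k))
slide-distance-mixed : (A B : Subset n) → ∣ A ∣ ≡ k → ∣ B ∣ ≡ suc k →
                       DistLe (SlideGraph (suc n)) (inside ∷ A) (outside ∷ B) (suc k * (suc n ∸ suc k))

slide-distance [] [] _ _ = 0 , z≤n , []
slide-distance {k = suc k} (inside ∷ A) (inside ∷ B) p q =
  DistLe-mono (m≤n+m _ _)
    (DistLe-map (inside ∷_) (there inside) (slide-distance A B (suc-injective p) (suc-injective q)))
slide-distance {suc n} {k} (outside ∷ A) (outside ∷ B) p q =
  DistLe-mono (*-monoʳ-≤ k (∸-monoˡ-≤ k (n≤1+n n)))
    (DistLe-map (outside ∷_) (there outside) (slide-distance A B p q))
slide-distance {k = suc k} (inside ∷ A) (outside ∷ B) p q =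
  slide-distance-mixed A B (suc-injective p) q
slide-distance {k = suc k} (outside ∷ A) (inside ∷ B) p q =
  DistLe-sym slide-sym (slide-distance-mixed B A (suc-injective q) p)
slide-distance {k = zero} (inside ∷ A)  _            () _
slide-distance {k = zero} (outside ∷ A) (inside ∷ B) _  ()

slide-distance-mixed {n} {k} A B p q with C , ∣C∣≡k , B⇝C ← slide-to-front (outside ∷ B) q =
  subst (DistLe _ _ _) (+-comm (k * (n ∸ k)) (n ∸ k))
    (DistLe-trans (DistLe-map (inside ∷_) (there inside) (slide-distance A C p ∣C∣≡k))
                  (DistLe-sym slide-sym B⇝C))

walk-Γ₃P : ∀ {l} → Walk (SlideGraph n) A B l → (p : ∣ A ∣ ≡ 3) (q : ∣ B ∣ ≡ 3) →
           Walk (Γ₃P n) (A , p) (B , q) l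
walk-Γ₃P {A = A} [] p q = subst (λ q → Walk (Γ₃P _) (A , p) (A , q) 0) (≡-irrelevant p q) []
walk-Γ₃P {A = A} (_∷_ {v = C} s w) p q = slide⇒adj {u = A , p} {v = C , p′} s ∷ walk-Γ₃P w p′ q
  where p′ = trans (sym (slide-size s)) p

weight-⊥ : ∀ n → weight (⊥ {n}) ≡ 0
weight-⊥ zero    = refl
weight-⊥ (suc n) = weight-⊥ n

packedLeft : ∀ j → V (Γ₃P (3 + j))
packedLeft j = inside ∷ inside ∷ inside ∷ ⊥ , cong (3 +_) (∣⊥∣≡0 j)

packedRight : ∀ j → V (Γ₃P (3 + j))
packedRight zero    = inside ∷ inside ∷ inside ∷ [] , refl
packedRight (suc j) = outside ∷ proj₁ (packedRight j) , proj₂ (packedRight j)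

weight-packedLeft : ∀ j → weight (proj₁ (packedLeft j)) ≡ 3 + 3 * j
weight-packedLeft j = begin
  (2 + j) + ((1 + j) + (j + weight (⊥ {j})))
    ≡⟨ cong (λ w → (2 + j) + ((1 + j) + (j + w))) (weight-⊥ j) ⟩
  (2 + j) + ((1 + j) + (j + 0))
    ≡⟨ solve [ j ] ⟩
  3 + 3 * j ∎
  where open ≡-Reasoning

weight-packedRight : ∀ j → weight (proj₁ (packedRight j)) ≡ 3
weight-packedRight zero    = refl
weight-packedRight (suc j) = weight-packedRight j

Γ₃P-diameter : 3 ≤ n → Diameter (Γ₃P n) (3 * (n ∸ 3))
Γ₃P-diameter {n = suc (suc (suc j))} (s≤s (s≤s (s≤s z≤n))) = close , packedRight j , packedLeft j , far
  where
  close : ∀ u v → DistLe (Γ₃P (3 + j)) u v (3 * j)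
  close (A , p) (B , q) with l , l≤ , w ← slide-distance A B p q = l , l≤ , walk-Γ₃P w p q
  far : ∀ l → Walk (Γ₃P (3 + j)) (packedRight j) (packedLeft j) l → 3 * j ≤ l
  far l w = +-cancelˡ-≤ 3 _ _
    (subst₂ _≤_ (weight-packedLeft j) (cong (_+ l) (weight-packedRight j))
      (walk-lipschitz (weight ∘ proj₁) (λ {u} {v} a → slide-weight≤ (adj⇒slide {u = u} {v} a)) w))

-- Independence number

p+[p+q]≡q : ∀ p q → p ℙ.+ (p ℙ.+ q) ≡ q
p+[p+q]≡q p q = trans (sym (ℙₚ.+-assoc p p q)) (cong (ℙ._+ q) (ℙₚ.p+p≡0ℙ p))

parity[m+w]⇒parity[w] : ∀ m w {p} → parity (m + w) ≡ p → parity w ≡ parity m ℙ.+ p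
parity[m+w]⇒parity[w] m w {p} e = begin
  parity w                              ≡⟨ p+[p+q]≡q (parity m) (parity w) ⟨
  parity m ℙ.+ (parity m ℙ.+ parity w)  ≡⟨ cong (parity m ℙ.+_) (ℙₚ.+-homo-+ m w) ⟨
  parity m ℙ.+ parity (m + w)           ≡⟨ cong (parity m ℙ.+_) e ⟩
  parity m ℙ.+ p                        ∎
  where open ≡-Reasoning

parity[w]⇒parity[m+w] : ∀ m w {p} → parity w ≡ parity m ℙ.+ p → parity (m + w) ≡ p
parity[w]⇒parity[m+w] m w {p} e = begin
  parity (m + w)                ≡⟨ ℙₚ.+-homo-+ m w ⟩
  parity m ℙ.+ parity w         ≡⟨ cong (parity m ℙ.+_) e ⟩
  parity m ℙ.+ (parity m ℙ.+ p) ≡⟨ p+[p+q]≡q (parity m) p ⟩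
  p                             ∎
  where open ≡-Reasoning

consOutside : SizedSubset n k → SizedSubset (suc n) k
consOutside (A , p) = outside ∷ A , p

consInside : SizedSubset n k → SizedSubset (suc n) (suc k)
consInside (A , p) = inside ∷ A , cong suc p

consOutside-injective : {u v : SizedSubset n k} → consOutside u ≡ consOutside v → u ≡ v
consOutside-injective e = sized-≡ (∷-injectiveʳ (cong proj₁ e))

consInside-injective : {u v : SizedSubset n k} → consInside u ≡ consInside v → u ≡ v
consInside-injective e = sized-≡ (∷-injectiveʳ (cong proj₁ e))

ofParity : ∀ n k → Parity → List (SizedSubset n k)
ofParity zero    zero    0ℙ = [ [] , refl ]
ofParity zero    zero    1ℙ = []
ofParity zero    (suc k) _  = []
ofParity (suc n) zero    p  = map consOutside (ofParity n zero p)
ofParity (suc n) (suc k) p  =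
  map consOutside (ofParity n (suc k) p) ++ map consInside (ofParity n k (parity n ℙ.+ p))

∈-ofParity⁻ : ∀ n k p {u} → u ∈ ofParity n k p → parity (weight (proj₁ u)) ≡ p
∈-ofParity⁻ zero    zero    0ℙ (here refl) = refl
∈-ofParity⁻ (suc n) zero    p  u∈ with _ , u∈′ , refl ← ∈-map⁻ consOutside u∈ = ∈-ofParity⁻ n zero p u∈′
∈-ofParity⁻ (suc n) (suc k) p  u∈ with ∈-++⁻ (map consOutside (ofParity n (suc k) p)) u∈
... | inj₁ u∈ˡ with _ , u∈′ , refl ← ∈-map⁻ consOutside u∈ˡ = ∈-ofParity⁻ n (suc k) p u∈′
... | inj₂ u∈ʳ with (A , _) , u∈′ , refl ← ∈-map⁻ consInside u∈ʳ =
  parity[w]⇒parity[m+w] n (weight A) (∈-ofParity⁻ n k _ u∈′)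

∈-ofParity⁺ : ∀ n k p (u : SizedSubset n k) → parity (weight (proj₁ u)) ≡ p → u ∈ ofParity n k p
∈-ofParity⁺ zero    zero    0ℙ ([] , refl) _ = here refl
∈-ofParity⁺ (suc n) zero    p  (outside ∷ A , e) w =
  ∈-map⁺ consOutside (∈-ofParity⁺ n zero p (A , e) w)
∈-ofParity⁺ (suc n) (suc k) p  (outside ∷ A , e) w =
  ∈-++⁺ˡ (∈-map⁺ consOutside (∈-ofParity⁺ n (suc k) p (A , e) w))
∈-ofParity⁺ (suc n) (suc k) p  (inside ∷ A , e) w =
  ∈-++⁺ʳ (map consOutside (ofParity n (suc k) p))
    (subst (_∈ map consInside (ofParity n k (parity n ℙ.+ p))) (sized-≡ refl)
      (∈-map⁺ consInside
        (∈-ofParity⁺ n k _ (A , suc-injective e) (parity[m+w]⇒parity[w] n (weight A) w))))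

ofParity-unique : ∀ n k p → Unique (ofParity n k p)
ofParity-unique zero    zero    0ℙ = [] ∷ []
ofParity-unique zero    zero    1ℙ = []
ofParity-unique zero    (suc k) _  = []
ofParity-unique (suc n) zero    p  = Unique.map⁺ consOutside-injective (ofParity-unique n zero p)
ofParity-unique (suc n) (suc k) p  =
  Unique.++⁺ (Unique.map⁺ consOutside-injective (ofParity-unique n (suc k) p))
             (Unique.map⁺ consInside-injective (ofParity-unique n k _))
             disjoint
  where
  disjoint : ∀ {u} → ¬ (u ∈ map consOutside (ofParity n (suc k) p)
                      × u ∈ map consInside (ofParity n k (parity n ℙ.+ p)))
  disjoint (u∈ˡ , u∈ʳ) with ∈-map⁻ consOutside u∈ˡ | ∈-map⁻ consInside u∈ʳ
  ... | _ , _ , refl | _ , _ , ()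

count : ℕ → ℕ → Parity → ℕ
count n k p = length (ofParity n k p)

oddTriples-independent : ∀ n → IsIndependent (Γ₃P n) (ofParity n 3 1ℙ)
oddTriples-independent n = ofParity-unique n 3 1ℙ , λ {u} {v} u∈ v∈ a →
  ℙₚ.p≢p⁻¹ 1ℙ (begin
    1ℙ                            ≡⟨ ∈-ofParity⁻ n 3 1ℙ v∈ ⟨
    parity (weight (proj₁ v))     ≡⟨ adj-parity {u = u} {v} a ⟩
    parity (weight (proj₁ u)) ⁻¹  ≡⟨ cong _⁻¹ (∈-ofParity⁻ n 3 1ℙ u∈) ⟩
    1ℙ ⁻¹                         ∎)
  where open ≡-Reasoning

partner : Subset n → Subset n
partner []                      = []
partner (x ∷ [])                = x ∷ []
partner (inside  ∷ outside ∷ A) = outside ∷ inside ∷ A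
partner (outside ∷ inside  ∷ A) = inside ∷ outside ∷ A
partner (inside  ∷ inside  ∷ A) = inside ∷ inside ∷ partner A
partner (outside ∷ outside ∷ A) = outside ∷ outside ∷ partner A

partner-involutive : (A : Subset n) → partner (partner A) ≡ A
partner-involutive []                      = refl
partner-involutive (x ∷ [])                = refl
partner-involutive (inside  ∷ outside ∷ A) = refl
partner-involutive (outside ∷ inside  ∷ A) = refl
partner-involutive (inside  ∷ inside  ∷ A) = cong (λ C → inside ∷ inside ∷ C) (partner-involutive A)
partner-involutive (outside ∷ outside ∷ A) = cong (λ C → outside ∷ outside ∷ C) (partner-involutive A)

partner-size : (A : Subset n) → ∣ partner A ∣ ≡ ∣ A ∣
partner-size []                      = refl
partner-size (x ∷ [])                = refl
partner-size (inside  ∷ outside ∷ A) = refl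
partner-size (outside ∷ inside  ∷ A) = refl
partner-size (inside  ∷ inside  ∷ A) = cong (λ c → suc (suc c)) (partner-size A)
partner-size (outside ∷ outside ∷ A) = partner-size A

parity[m+[m+w]] : ∀ m w → parity (m + (m + w)) ≡ parity w
parity[m+[m+w]] m w = parity[w]⇒parity[m+w] m (m + w) (ℙₚ.+-homo-+ m w)

-- Without a half-filled pair the tokens form full pairs, each of odd weight, plus
-- possibly one token on the last vertex, of weight 0.
partner-slide : (A : Subset n) → Slide A (partner A) ⊎ parity (weight A) ≡ parity ⌊ ∣ A ∣ /2⌋
partner-slide []                      = inj₂ refl
partner-slide (inside ∷ [])           = inj₂ refl
partner-slide (outside ∷ [])          = inj₂ refl
partner-slide (inside  ∷ outside ∷ A) = inj₁ right
partner-slide (outside ∷ inside  ∷ A) = inj₁ left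
partner-slide {suc (suc n)} (inside ∷ inside ∷ A) with partner-slide A
... | inj₁ s = inj₁ (there inside (there inside s))
... | inj₂ e = inj₂ (begin
  parity (suc (n + (n + weight A))) ≡⟨ parity-suc (n + (n + weight A)) ⟩
  parity (n + (n + weight A)) ⁻¹    ≡⟨ cong _⁻¹ (trans (parity[m+[m+w]] n (weight A)) e) ⟩
  parity ⌊ ∣ A ∣ /2⌋ ⁻¹             ≡⟨ parity-suc ⌊ ∣ A ∣ /2⌋ ⟨
  parity (suc ⌊ ∣ A ∣ /2⌋)          ∎)
  where open ≡-Reasoning
partner-slide (outside ∷ outside ∷ A) with partner-slide A
... | inj₁ s = inj₁ (there outside (there outside s))
... | inj₂ e = inj₂ e

even⇒slide-partner : ∣ A ∣ ≡ 3 → parity (weight A) ≡ 0ℙ → Slide A (partner A)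
even⇒slide-partner {A = A} size even with partner-slide A
... | inj₁ s = s
... | inj₂ e = contradiction (trans (sym even) (trans e (cong (λ c → parity ⌊ c /2⌋) size))) λ ()

toOdd : V (Γ₃P n) → V (Γ₃P n)
toOdd (A , p) with parity (weight A)
... | 0ℙ = partner A , trans (partner-size A) p
... | 1ℙ = A , p

toOdd-odd : (u : V (Γ₃P n)) → parity (weight (proj₁ (toOdd u))) ≡ 1ℙ
toOdd-odd (A , p) with parity (weight A) in e
... | 0ℙ = trans (slide-parity (even⇒slide-partner {A = A} p e)) (cong _⁻¹ e)
... | 1ℙ = e

toOdd-collapse : u ≢ v → toOdd u ≡ toOdd v → Adj (Γ₃P n) u v
toOdd-collapse {u = A , p} {v = B , q} u≢v e with parity (weight A) in eA | parity (weight B) in eB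
... | 0ℙ | 0ℙ = contradiction (sized-≡ (begin
  A                   ≡⟨ partner-involutive A ⟨
  partner (partner A) ≡⟨ cong (partner ∘ proj₁) e ⟩
  partner (partner B) ≡⟨ partner-involutive B ⟩
  B                   ∎)) u≢v
  where open ≡-Reasoning
... | 0ℙ | 1ℙ = slide⇒adj {u = A , p} {B , q} (subst (Slide A) (cong proj₁ e) (even⇒slide-partner p eA))
... | 1ℙ | 0ℙ = slide⇒adj {u = A , p} {B , q}
                  (subst (λ C → Slide C B) (sym (cong proj₁ e)) (slide-sym (even⇒slide-partner q eB)))
... | 1ℙ | 1ℙ = contradiction e u≢v

Γ₃P-α≡#oddTriples : ∀ n → IndependenceNumber (Γ₃P n) (count n 3 1ℙ)
Γ₃P-α≡#oddTriples n =
  independenceNumber-via-collapse (Γ₃P n) (oddTriples-independent n) toOdd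
    (λ {u} {v} → toOdd-collapse {u = u} {v}) (λ u → ∈-ofParity⁺ n 3 1ℙ (toOdd u) (toOdd-odd u))

-- Counting the odd-weight triples

count-suc : ∀ n {q} → parity n ≡ q → ∀ k p →
            count (suc n) (suc k) p ≡ count n (suc k) p + count n k (q ℙ.+ p)
count-suc n n-parity k p =
  trans (length-++ (map consOutside (ofParity n (suc k) p)))
        (cong₂ _+_ (length-map consOutside (ofParity n (suc k) p))
                   (trans (length-map consInside (ofParity n k (parity n ℙ.+ p)))
                          (cong (λ q → count n k (q ℙ.+ p)) n-parity)))

3*count-suc : ∀ n {q} → parity n ≡ q →
              3 * count (suc n) 3 1ℙ ≡ 3 * count n 3 1ℙ + 3 * count n 2 (q ℙ.+ 1ℙ)
3*count-suc n n-parity =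
  trans (cong (3 *_) (count-suc n n-parity 2 1ℙ)) (*-distribˡ-+ 3 (count n 3 1ℙ) _)

count-empty₀ : ∀ n → count n 0 0ℙ ≡ 1
count-empty₀ zero    = refl
count-empty₀ (suc n) = trans (length-map consOutside (ofParity n 0 0ℙ)) (count-empty₀ n)

count-empty₁ : ∀ n → count n 0 1ℙ ≡ 0
count-empty₁ zero    = refl
count-empty₁ (suc n) = trans (length-map consOutside (ofParity n 0 1ℙ)) (count-empty₁ n)

record Counts (n a₀ a₁ b₀ b₁ c : ℕ) : Set where
  field
    one₀   : count n 1 0ℙ ≡ a₀
    one₁   : count n 1 1ℙ ≡ a₁
    two₀   : count n 2 0ℙ ≡ b₀
    two₁   : count n 2 1ℙ ≡ b₁
    three₁ : 3 * count n 3 1ℙ ≡ c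

private variable
  a₀ a₁ b₀ b₁ c a₀′ a₁′ b₀′ b₁′ c′ : ℕ

Counts-resp : Counts n a₀ a₁ b₀ b₁ c → a₀ ≡ a₀′ → a₁ ≡ a₁′ → b₀ ≡ b₀′ → b₁ ≡ b₁′ → c ≡ c′ →
              Counts n a₀′ a₁′ b₀′ b₁′ c′
Counts-resp C refl refl refl refl refl = C

Counts-suc-even : ∀ n → parity n ≡ 0ℙ → Counts n a₀ a₁ b₀ b₁ c →
                  Counts (suc n) (a₀ + 1) (a₁ + 0) (b₀ + a₀) (b₁ + a₁) (c + 3 * b₁)
Counts-suc-even n even C = record
  { one₀   = trans (count-suc n even 0 0ℙ) (cong₂ _+_ one₀ (count-empty₀ n))
  ; one₁   = trans (count-suc n even 0 1ℙ) (cong₂ _+_ one₁ (count-empty₁ n))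
  ; two₀   = trans (count-suc n even 1 0ℙ) (cong₂ _+_ two₀ one₀)
  ; two₁   = trans (count-suc n even 1 1ℙ) (cong₂ _+_ two₁ one₁)
  ; three₁ = trans (3*count-suc n even) (cong₂ _+_ three₁ (cong (3 *_) two₁))
  }
  where open Counts C

Counts-suc-odd : ∀ n → parity n ≡ 1ℙ → Counts n a₀ a₁ b₀ b₁ c →
                 Counts (suc n) (a₀ + 0) (a₁ + 1) (b₀ + a₁) (b₁ + a₀) (c + 3 * b₀)
Counts-suc-odd n odd C = record
  { one₀   = trans (count-suc n odd 0 0ℙ) (cong₂ _+_ one₀ (count-empty₁ n))
  ; one₁   = trans (count-suc n odd 0 1ℙ) (cong₂ _+_ one₁ (count-empty₀ n))
  ; two₀   = trans (count-suc n odd 1 0ℙ) (cong₂ _+_ two₀ one₁)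
  ; two₁   = trans (count-suc n odd 1 1ℙ) (cong₂ _+_ two₁ one₀)
  ; three₁ = trans (3*count-suc n odd) (cong₂ _+_ three₁ (cong (3 *_) two₀))
  }
  where open Counts C

parity[m*2] : ∀ m → parity (m * 2) ≡ 0ℙ
parity[m*2] zero    = refl
parity[m*2] (suc m) = parity[m*2] m

parity[1+m*2] : ∀ m → parity (1 + m * 2) ≡ 1ℙ
parity[1+m*2] zero    = refl
parity[1+m*2] (suc m) = parity[1+m*2] m

counts[1+m*2] : ∀ m → Counts (1 + m * 2) (1 + m) m (m * m) (m * (1 + m)) (m * (2 * (m * m) + 1))
counts[1+m*2] zero    = record { one₀ = refl ; one₁ = refl ; two₀ = refl ; two₁ = refl ; three₁ = refl }
counts[1+m*2] (suc m) =
  Counts-resp (Counts-suc-even (2 + m * 2) (parity[m*2] (suc m))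
                (Counts-suc-odd (1 + m * 2) (parity[1+m*2] m) (counts[1+m*2] m)))
    (solve [ m ]) (solve [ m ]) (solve [ m ]) (solve [ m ]) (solve [ m ])

twelve-times : ∀ x {y} → 3 * x ≡ y → x * 12 ≡ 4 * y
twelve-times x refl = trans (*-comm x 12) (*-assoc 4 3 x)

even-cubic : ∀ m → 4 * (m * (2 * (m * m) + 1) + 3 * (m * m)) + 3 * (2 + m * 2) ^ 2
                 ≡ (2 + m * 2) ^ 3 + 2 * (2 + m * 2)
even-cubic = +-*-Solver.solve 1 (λ m →
    con 4 :* (m :* (con 2 :* (m :* m) :+ con 1) :+ con 3 :* (m :* m))
      :+ con 3 :* (con 2 :+ m :* con 2) :^ 2
  := (con 2 :+ m :* con 2) :^ 3 :+ con 2 :* (con 2 :+ m :* con 2)) refl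
  where open +-*-Solver using (con; _:+_; _:*_; _:^_; _:=_)

odd-cubic : ∀ m → 4 * (m * (2 * (m * m) + 1)) + (3 + 3 * (1 + m * 2) ^ 2)
                ≡ (1 + m * 2) ^ 3 + 5 * (1 + m * 2)
odd-cubic = +-*-Solver.solve 1 (λ m →
    con 4 :* (m :* (con 2 :* (m :* m) :+ con 1)) :+ (con 3 :+ con 3 :* (con 1 :+ m :* con 2) :^ 2)
  := (con 1 :+ m :* con 2) :^ 3 :+ con 5 :* (con 1 :+ m :* con 2)) refl
  where open +-*-Solver using (con; _:+_; _:*_; _:^_; _:=_)

-- The closed forms of the theorem, with 3n² (and 3) moved to the left so that no
-- truncated subtraction occurs.
#oddTriples[m*2] : ∀ m → count (m * 2) 3 1ℙ * 12 + 3 * (m * 2) ^ 2 ≡ (m * 2) ^ 3 + 2 * (m * 2)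
#oddTriples[m*2] zero    = refl
#oddTriples[m*2] (suc m) =
  trans (cong (_+ 3 * (2 + m * 2) ^ 2) (twelve-times (count (2 + m * 2) 3 1ℙ) (Counts.three₁ C)))
        (even-cubic m)
  where C = Counts-suc-odd (1 + m * 2) (parity[1+m*2] m) (counts[1+m*2] m)

#oddTriples[1+m*2] : ∀ m → count (1 + m * 2) 3 1ℙ * 12 + (3 + 3 * (1 + m * 2) ^ 2)
                        ≡ (1 + m * 2) ^ 3 + 5 * (1 + m * 2)
#oddTriples[1+m*2] m =
  trans (cong (_+ (3 + 3 * (1 + m * 2) ^ 2))
              (twelve-times (count (1 + m * 2) 3 1ℙ) (Counts.three₁ (counts[1+m*2] m))))
        (odd-cubic m)

exact-quotient : ∀ {a b c d x} k .{{_ : NonZero k}} → a ≤ b → x * k + (d + a) ≡ b + c →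
                 (b ∸ a + c ∸ d) / k ≡ x
exact-quotient {a} {b} {c} {d} {x} k a≤b e = trans (cong (_/ k) (begin
  b ∸ a + c ∸ d             ≡⟨ cong (_∸ d) (+-∸-comm c a≤b) ⟨
  b + c ∸ a ∸ d             ≡⟨ ∸-+-assoc (b + c) a d ⟩
  b + c ∸ (a + d)           ≡⟨ cong₂ _∸_ (sym e) (+-comm a d) ⟩
  x * k + (d + a) ∸ (d + a) ≡⟨ m+n∸n≡m (x * k) (d + a) ⟩
  x * k                     ∎)) (m*n/n≡m x k)
  where open ≡-Reasoning

¬2∣⇒≡1+m*2 : ¬ 2 ∣ n → ∃[ m ] n ≡ 1 + m * 2
¬2∣⇒≡1+m*2 {n} 2∤n with n % 2 in r | m%n<n n 2
... | 0           | _                = contradiction (m%n≡0⇒n∣m n 2 r) 2∤n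
... | 1           | _                = n / 2 , trans (m≡m%n+[m/n]*n n 2) (cong (_+ n / 2 * 2) r)
... | suc (suc _) | s≤s (s≤s ())

#oddTriples-even : 3 ≤ n → 2 ∣ n → count n 3 1ℙ ≡ ((n ^ 3 ∸ 3 * n ^ 2) + 2 * n) / 12
#oddTriples-even {n} 3≤n (divides m refl) =
  sym (exact-quotient {c = 2 * n} {d = 0} 12 (*-monoˡ-≤ (n ^ 2) 3≤n) (#oddTriples[m*2] m))

#oddTriples-odd : 3 ≤ n → ¬ 2 ∣ n → count n 3 1ℙ ≡ ((n ^ 3 ∸ 3 * n ^ 2) + 5 * n ∸ 3) / 12
#oddTriples-odd {n} 3≤n 2∤n with m , refl ← ¬2∣⇒≡1+m*2 2∤n =
  sym (exact-quotient {c = 5 * n} {d = 3} 12 (*-monoˡ-≤ (n ^ 2) 3≤n) (#oddTriples[1+m*2] m))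

corollary2 : (n : ℕ) → 3 ≤ n →
    ((n ≡ 3 → ChromaticNumber (Γ₃P n) 1 × CliqueNumber (Γ₃P n) 1)
     × (3 < n → ChromaticNumber (Γ₃P n) 2 × CliqueNumber (Γ₃P n) 2))
    × ((2 ∣ n → IndependenceNumber (Γ₃P n) (((n ^ 3 ∸ 3 * n ^ 2) + 2 * n) / 12))
     × (¬ 2 ∣ n → IndependenceNumber (Γ₃P n) (((n ^ 3 ∸ 3 * n ^ 2) + 5 * n ∸ 3) / 12)))
    × Diameter (Γ₃P n) (3 * (n ∸ 3))
corollary2 n 3≤n =
    (Γ₃P-χ≡ω≡1 , Γ₃P-χ≡ω≡2)
  , ( (λ 2∣n → subst (IndependenceNumber (Γ₃P n)) (#oddTriples-even 3≤n 2∣n) (Γ₃P-α≡#oddTriples n))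
    , (λ 2∤n → subst (IndependenceNumber (Γ₃P n)) (#oddTriples-odd 3≤n 2∤n) (Γ₃P-α≡#oddTriples n)))
  , Γ₃P-diameter 3≤n
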